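{- A 3-regular graph $G$ is graceful 5-colorable if and only if $G$ is distance-two 4-colorable.
   Context: Graphs are finite and simple. A graceful coloring of $G$ is a function $f\colon V(G)\to\mathbb{N}$ with two properties. First, $f$ is a proper vertex coloring. Second, the labelling $h(uv)=|f(u)-f(v)|$ on edges is a proper edge coloring, meaning edges sharing an endpoint get distinct labels. $G$ is graceful $k$-colorable if it has a graceful coloring with range contained in $\{1,\dots,k\}$. A distance-two $q$-coloring of $G$ is a proper vertex coloring with at most $q$ colors in which, in addition, any two vertices with a common neighbour receive distinct colors. Equivalently, it is a proper $q$-coloring of the square graph $G^2$. -}

module Defs where

open import Data.Nat using (ℕ; suc; _≤_; _∸_; _⊔_)
open import Data.Nat.Properties using ()
open import Data.Bool using (Bool; true; false; T)
open import Data.Fin using (Fin)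
open import Data.List using (List; length; filterᵇ; allFin)
open import Data.Product using (Σ; ∃; _×_; _,_)
open import Relation.Binary.PropositionalEquality using (_≡_; _≢_)
open import Relation.Nullary using (¬_)

record Graph (n : ℕ) : Set where
  field
    adj   : Fin n → Fin n → Bool
    sym   : ∀ u v → adj u v ≡ adj v u
    irrefl : ∀ v → adj v v ≡ false
open Graph public

Adj : ∀ {n} → Graph n → Fin n → Fin n → Set
Adj G u v = T (adj G u v)

degree : ∀ {n} → Graph n → Fin n → ℕ
degree {n} G v = length (filterᵇ (adj G v) (allFin n))

Regular : ∀ {n} → ℕ → Graph n → Set
Regular k G = ∀ v → degree G v ≡ k

absDiff : ℕ → ℕ → ℕ
absDiff a b = (a ∸ b) ⊔ (b ∸ a)

IsGracefulColoring : ∀ {n} → Graph n → (Fin n → ℕ) → Set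
IsGracefulColoring G f =
  (∀ u v → Adj G u v → f u ≢ f v) ×
  (∀ u v w → Adj G u v → Adj G u w → v ≢ w → absDiff (f u) (f v) ≢ absDiff (f u) (f w))

GracefulColorable : ∀ {n} → ℕ → Graph n → Set
GracefulColorable {n} k G =
  Σ (Fin n → ℕ) λ f → IsGracefulColoring G f × (∀ v → 1 ≤ f v × f v ≤ k)

IsDistanceTwoColoring : ∀ {n q} → Graph n → (Fin n → Fin q) → Set
IsDistanceTwoColoring G c =
  (∀ u v → Adj G u v → c u ≢ c v) ×
  (∀ u v w → Adj G w u → Adj G w v → u ≢ v → c u ≢ c v)

DistanceTwoColorable : ∀ {n} → ℕ → Graph n → Set
DistanceTwoColorable {n} q G = Σ (Fin n → Fin q) λ c → IsDistanceTwoColoring G c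

-- In a graceful 5-colouring of a cubic graph no vertex gets colour 3: its three
-- neighbours would get colours in {1,2,4,5}, so its three edges would carry three
-- distinct labels from {1,2}. Hence all colours lie in {1,2,4,5}. No element of
-- {1,2,4,5} is equidistant from two others, so for colourings with values in this
-- set, distinct labels at u amount to distinct colours on the neighbourhood of u,
-- which is the distance-two condition.
module Submission where

open import Defs hiding (sym)
open import Data.Nat using (ℕ; suc; _≤_; s≤s)
import Data.Nat.Properties as ℕ
open import Data.Fin using (Fin; zero; suc)
open import Data.Fin.Properties using (all?; _≟_)
open import Data.Bool.Properties using (T?)
open import Data.Empty using (⊥; ⊥-elim)
open import Data.Sum using (_⊎_; inj₁; inj₂)
open import Data.Product using (_×_; _,_; proj₁; proj₂; ∃-syntax)
open import Data.List using (List; _∷_; length; allFin)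
open import Data.List.Relation.Unary.All using (All; _∷_)
open import Data.List.Relation.Unary.All.Properties using (all-filter)
open import Data.List.Relation.Unary.AllPairs using (_∷_)
open import Data.List.Relation.Unary.Unique.Propositional using (Unique)
open import Data.List.Relation.Unary.Unique.Propositional.Properties using (filter⁺; allFin⁺)
open import Function using (_∘_)
open import Function.Definitions using (Injective)
open import Relation.Binary.PropositionalEquality
  using (_≡_; _≢_; _≗_; refl; sym; trans; cong; module ≡-Reasoning)
open import Relation.Nullary.Decidable using (toWitness; ¬?; _→-dec_; _×-dec_)

three-distinct : ∀ {A : Set} {P : A → Set} {xs : List A} →
  3 ≤ length xs → Unique xs → All P xs →
  ∃[ a ] ∃[ b ] ∃[ c ] P a × P b × P c × a ≢ b × a ≢ c × b ≢ c
three-distinct {xs = a ∷ b ∷ c ∷ _} (s≤s (s≤s (s≤s _)))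
  ((a≢b ∷ a≢c ∷ _) ∷ (b≢c ∷ _) ∷ _) (pa ∷ pb ∷ pc ∷ _) =
  a , b , c , pa , pb , pc , a≢b , a≢c , b≢c

no-three-distinct-in-pair : ∀ {A : Set} {x y a b c : A} →
  a ≡ x ⊎ a ≡ y → b ≡ x ⊎ b ≡ y → c ≡ x ⊎ c ≡ y →
  a ≢ b → a ≢ c → b ≢ c → ⊥
no-three-distinct-in-pair (inj₁ refl) (inj₁ refl) _           a≢b _   _   = a≢b refl
no-three-distinct-in-pair (inj₂ refl) (inj₂ refl) _           a≢b _   _   = a≢b refl
no-three-distinct-in-pair (inj₁ refl) (inj₂ refl) (inj₁ refl) _   a≢c _   = a≢c refl
no-three-distinct-in-pair (inj₂ refl) (inj₁ refl) (inj₂ refl) _   a≢c _   = a≢c refl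
no-three-distinct-in-pair (inj₁ refl) (inj₂ refl) (inj₂ refl) _   _   b≢c = b≢c refl
no-three-distinct-in-pair (inj₂ refl) (inj₁ refl) (inj₁ refl) _   _   b≢c = b≢c refl

EquidistanceFree : ∀ {q} → (Fin q → ℕ) → Set
EquidistanceFree h = ∀ i j k → i ≢ j → i ≢ k → j ≢ k → absDiff (h i) (h j) ≢ absDiff (h i) (h k)

module _ {n : ℕ} (G : Graph n) where

  three-distinct-neighbours : ∀ {v} → 3 ≤ degree G v →
    ∃[ a ] ∃[ b ] ∃[ c ] Adj G v a × Adj G v b × Adj G v c × a ≢ b × a ≢ c × b ≢ c
  three-distinct-neighbours {v} deg≥3 = three-distinct deg≥3
    (filter⁺ (T? ∘ adj G v) (allFin⁺ n)) (all-filter (T? ∘ adj G v) (allFin n))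

  graceful⇒distance-two : ∀ {q} {f : Fin n → ℕ} {h : Fin q → ℕ} {c : Fin n → Fin q} →
    IsGracefulColoring G f → f ≗ h ∘ c → IsDistanceTwoColoring G c
  graceful⇒distance-two {f = f} {h} {c} (proper , labels-distinct) f≗h∘c =
    (λ u v u~v → proper u v u~v ∘ same-colour) ,
    (λ u v w w~u w~v u≢v →
      labels-distinct w u v w~u w~v u≢v ∘ cong (absDiff (f w)) ∘ same-colour)
    where
    open ≡-Reasoning
    same-colour : ∀ {u v} → c u ≡ c v → f u ≡ f v
    same-colour {u} {v} cu≡cv = begin
      f u       ≡⟨ f≗h∘c u ⟩
      h (c u)   ≡⟨ cong h cu≡cv ⟩
      h (c v)   ≡⟨ sym (f≗h∘c v) ⟩
      f v       ∎

  distance-two⇒graceful : ∀ {q} {h : Fin q → ℕ} {c : Fin n → Fin q} →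
    Injective _≡_ _≡_ h → EquidistanceFree h →
    IsDistanceTwoColoring G c → IsGracefulColoring G (h ∘ c)
  distance-two⇒graceful h-injective h-equidistance-free (proper , distance-two) =
    (λ u v u~v → proper u v u~v ∘ h-injective) ,
    (λ u v w u~v u~w v≢w → h-equidistance-free _ _ _
      (proper u v u~v) (proper u w u~w) (distance-two v w u u~v u~w v≢w))

skip-3 : Fin 4 → ℕ
skip-3 zero                   = 1
skip-3 (suc zero)             = 2
skip-3 (suc (suc zero))       = 4
skip-3 (suc (suc (suc zero))) = 5

skip-3-in-range : ∀ i → 1 ≤ skip-3 i × skip-3 i ≤ 5
skip-3-in-range = toWitness {a? = all? λ i → 1 ℕ.≤? skip-3 i ×-dec skip-3 i ℕ.≤? 5} _

skip-3-onto : ∀ {x} → 1 ≤ x × x ≤ 5 → x ≢ 3 → ∃[ i ] x ≡ skip-3 i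
skip-3-onto {1} _ _   = zero , refl
skip-3-onto {2} _ _   = suc zero , refl
skip-3-onto {3} _ x≢3 = ⊥-elim (x≢3 refl)
skip-3-onto {4} _ _   = suc (suc zero) , refl
skip-3-onto {5} _ _   = suc (suc (suc zero)) , refl
skip-3-onto {suc (suc (suc (suc (suc (suc _)))))} (_ , s≤s (s≤s (s≤s (s≤s (s≤s ()))))) _

skip-3-injective : Injective _≡_ _≡_ skip-3
skip-3-injective {i} {j} =
  toWitness {a? = all? λ i → all? λ j → skip-3 i ℕ.≟ skip-3 j →-dec i ≟ j} _ i j

skip-3-equidistance-free : EquidistanceFree skip-3
skip-3-equidistance-free = toWitness {a? = all? λ i → all? λ j → all? λ k →
  ¬? (i ≟ j) →-dec ¬? (i ≟ k) →-dec ¬? (j ≟ k) →-dec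
  ¬? (absDiff (skip-3 i) (skip-3 j) ℕ.≟ absDiff (skip-3 i) (skip-3 k))} _

absDiff-3≡1⊎2 : ∀ {x} → 1 ≤ x × x ≤ 5 → x ≢ 3 → absDiff 3 x ≡ 1 ⊎ absDiff 3 x ≡ 2
absDiff-3≡1⊎2 {1} _ _   = inj₂ refl
absDiff-3≡1⊎2 {2} _ _   = inj₁ refl
absDiff-3≡1⊎2 {3} _ x≢3 = ⊥-elim (x≢3 refl)
absDiff-3≡1⊎2 {4} _ _   = inj₁ refl
absDiff-3≡1⊎2 {5} _ _   = inj₂ refl
absDiff-3≡1⊎2 {suc (suc (suc (suc (suc (suc _)))))} (_ , s≤s (s≤s (s≤s (s≤s (s≤s ()))))) _

graceful-5-avoids-3 : ∀ {n} (G : Graph n) {f : Fin n → ℕ} → IsGracefulColoring G f →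
  (∀ v → 1 ≤ f v × f v ≤ 5) → ∀ {v} → 3 ≤ degree G v → f v ≢ 3
graceful-5-avoids-3 G {f} (proper , labels-distinct) range {v} deg≥3 fv≡3
  with three-distinct-neighbours G deg≥3
... | a , b , c , v~a , v~b , v~c , a≢b , a≢c , b≢c =
  no-three-distinct-in-pair (label-1-or-2 v~a) (label-1-or-2 v~b) (label-1-or-2 v~c)
    (labels-distinct v a b v~a v~b a≢b) (labels-distinct v a c v~a v~c a≢c)
    (labels-distinct v b c v~b v~c b≢c)
  where
  label-1-or-2 : ∀ {u} → Adj G v u → absDiff (f v) (f u) ≡ 1 ⊎ absDiff (f v) (f u) ≡ 2
  label-1-or-2 {u} v~u rewrite fv≡3 =
    absDiff-3≡1⊎2 (range u) (λ fu≡3 → proper v u v~u (trans fv≡3 (sym fu≡3)))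

mainTheorem2 : ∀ {n : ℕ} (G : Graph n) → Regular 3 G →
    (GracefulColorable 5 G → DistanceTwoColorable 4 G) ×
    (DistanceTwoColorable 4 G → GracefulColorable 5 G)
mainTheorem2 G cubic = graceful-5⇒distance-two-4 , distance-two-4⇒graceful-5
  where
  graceful-5⇒distance-two-4 : GracefulColorable 5 G → DistanceTwoColorable 4 G
  graceful-5⇒distance-two-4 (f , graceful , range) =
    proj₁ ∘ preimage , graceful⇒distance-two G {h = skip-3} graceful (proj₂ ∘ preimage)
    where
    preimage : ∀ v → ∃[ i ] f v ≡ skip-3 i
    preimage v = skip-3-onto (range v)
      (graceful-5-avoids-3 G graceful range (ℕ.≤-reflexive (sym (cubic v))))

  distance-two-4⇒graceful-5 : DistanceTwoColorable 4 G → GracefulColorable 5 G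
  distance-two-4⇒graceful-5 (c , distance-two) =
    skip-3 ∘ c ,
    distance-two⇒graceful G skip-3-injective skip-3-equidistance-free distance-two ,
    skip-3-in-range ∘ c
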